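{- Let $r\in\mathbb{N}$ and let $a_{1},a_{2},\ldots,a_{n}$ be distinct natural numbers. Then for every partition of $\mathbb{N}$ into $r$ cells there exist $x,y,c\in\mathbb{N}$ such that the set \[ \left\{ x\,2^{c f(a)}\left(y+c\frac{a}{2^{f(a)}}\right):a\in\left\{ a_{1},a_{2},\ldots,a_{n}\right\} \right\} \] is contained in a single cell.
   Context: $\mathbb{N}$ is the set of positive integers. For $n\in\mathbb{N}$, $f(n)=\max\{x\in\mathbb{N}\cup\{0\}:2^{x}\mid n\}$ is the exponent of $2$ in $n$, so $n/2^{f(n)}$ is the odd part of $n$. -}

module Defs where

open import Data.Nat using (ℕ; zero; suc; _+_; _*_; _^_; _/_; _%_)
open import Data.Nat.Properties using (m^n≢0)

-- 2-adic valuation with fuel: go k m strips up to k factors of 2 from m.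
v2-go : ℕ → ℕ → ℕ
v2-go zero    m = 0
v2-go (suc k) zero = 0
v2-go (suc k) (suc m) with suc m % 2
... | zero  = suc (v2-go k (suc m / 2))
... | suc _ = 0

-- f n = max { x : 2^x ∣ n } for n ≥ 1 (fuel n suffices since 2^x ≤ n).
f : ℕ → ℕ
f n = v2-go n n

oddPart : ℕ → ℕ
oddPart n = _/_ n (2 ^ f n) {{m^n≢0 2 (f n)}}

elem : ℕ → ℕ → ℕ → ℕ → ℕ
elem x y c a = x * 2 ^ (c * f a) * (y + c * oddPart a)

-- Colour words w over the alphabet {1,…,n} by χ applied to 2^(Σ f(a_{w_j})) (1 + Σ odd(a_{w_j})).
-- By the Hales–Jewett theorem some combinatorial line τ is monochromatic; substituting the
-- letter i into τ gives exactly x 2^(c f(a_i)) (y + c odd(a_i)), where c is the number of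
-- wildcards of τ and x, y are read off from its fixed letters. Hales–Jewett itself is proved
-- by induction on the alphabet size, via the colour-focusing argument.
module Submission where

open import Defs
open import Data.Nat using (ℕ; zero; suc; _+_; _*_; _^_; _<_; s≤s; z≤n)
open import Data.Nat.Properties
  using (+-assoc; +-commutativeSemigroup; ^-distribˡ-+-*; m^n>0; n<1+n)
open import Algebra.Properties.CommutativeSemigroup +-commutativeSemigroup using (x∙yz≈y∙xz)
open import Data.Fin using (Fin; zero; suc; _≟_; funToFin; finToFun)
open import Data.Fin.Properties using (finToFun-funToFin; any?; <⇒notInjective; ¬Fin0)
open import Data.Maybe as Maybe using (Maybe; just; nothing; maybe; fromMaybe)
open import Data.Vec using (Vec; []; _∷_; _++_; map; sum; tabulate; lookup)
open import Data.Vec.Properties using (map-++; map-∘; map-id; map-cong; tabulate-cong; tabulate∘lookup)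
open import Data.Vec.Relation.Unary.Any as Any using (Any; here; there)
open import Data.Vec.Relation.Unary.Any.Properties using (++⁺ˡ; ++⁺ʳ; map⁺)
open import Data.Product using (Σ; ∃; _×_; _,_; proj₁; proj₂)
open import Data.Sum using (_⊎_; inj₁; inj₂; [_,_]′)
open import Data.Empty using (⊥-elim)
open import Function using (_∘_; id)
open import Function.Definitions using (Injective)
open import Relation.Nullary using (yes; no; contradiction)
open import Relation.Binary.PropositionalEquality

private variable
  A B C : Set
  K M N r s : ℕ

Template : Set → ℕ → Set
Template A N = Vec (Maybe A) N

line : Template A N → A → Vec A N
line τ a = map (fromMaybe a) τ

HasWildcard : Template A N → Set
HasWildcard = Any (_≡ nothing)

constant : Vec A N → Template A N
constant = map just

line-++ : (σ : Template A M) (τ : Template A N) (a : A) → line (σ ++ τ) a ≡ line σ a ++ line τ a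
line-++ σ τ a = map-++ (fromMaybe a) σ τ

line-constant : (w : Vec A N) (a : A) → line (constant w) a ≡ w
line-constant w a = trans (sym (map-∘ (fromMaybe a) just w)) (map-id w)

line-map : (g : A → B) (τ : Template A N) (a : A) →
  line (map (Maybe.map g) τ) (g a) ≡ map g (line τ a)
line-map g τ a = begin
  map (fromMaybe (g a)) (map (Maybe.map g) τ) ≡⟨ map-∘ _ _ τ ⟨
  map (fromMaybe (g a) ∘ Maybe.map g) τ       ≡⟨ map-cong fromMaybe-map τ ⟩
  map (g ∘ fromMaybe a) τ                     ≡⟨ map-∘ g (fromMaybe a) τ ⟩
  map g (map (fromMaybe a) τ)                 ∎
  where
  open ≡-Reasoning
  fromMaybe-map : ∀ m → fromMaybe (g a) (Maybe.map g m) ≡ g (fromMaybe a m)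
  fromMaybe-map nothing  = refl
  fromMaybe-map (just _) = refl

hasWildcard-map : (g : A → B) {τ : Template A N} → HasWildcard τ → HasWildcard (map (Maybe.map g) τ)
hasWildcard-map g = map⁺ ∘ Any.map (cong (Maybe.map g))

MonochromaticLine : (Vec A N → C) → Set
MonochromaticLine {A} {N} χ =
  Σ (Template A N) λ τ → HasWildcard τ × (∀ a b → χ (line τ a) ≡ χ (line τ b))

HalesJewett : ℕ → Set
HalesJewett K = ∀ r → ∃ λ N → (χ : Vec (Fin K) N → Fin r) → MonochromaticLine χ

monochromaticLine-prefix : (w : Vec A M) {χ : Vec A (M + N) → C} →
  MonochromaticLine (λ u → χ (w ++ u)) → MonochromaticLine χ
monochromaticLine-prefix w {χ} (τ , wild , mono) =
  constant w ++ τ , ++⁺ʳ (constant w) wild , λ a b → trans (on a) (trans (mono a b) (sym (on b)))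
  where
  on : ∀ a → χ (line (constant w ++ τ) a) ≡ χ (w ++ line τ a)
  on a = cong χ (trans (line-++ (constant w) τ a) (cong (_++ line τ a) (line-constant w a)))

halesJewett-unary : HalesJewett 1
halesJewett-unary r = 1 , λ χ → nothing ∷ [] , here refl , λ { zero zero → refl }

wordToFin : Vec (Fin K) N → Fin (K ^ N)
wordToFin u = funToFin (lookup u)

finToWord : Fin (K ^ N) → Vec (Fin K) N
finToWord i = tabulate (finToFun i)

finToWord-wordToFin : (u : Vec (Fin K) N) → finToWord (wordToFin u) ≡ u
finToWord-wordToFin u = trans (tabulate-cong (finToFun-funToFin (lookup u))) (tabulate∘lookup u)

encodeColouring : (Vec (Fin K) N → Fin r) → Fin (r ^ (K ^ N))
encodeColouring g = funToFin (g ∘ finToWord)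

encodeColouring-injective : (g h : Vec (Fin K) N → Fin r) →
  encodeColouring g ≡ encodeColouring h → ∀ u → g u ≡ h u
encodeColouring-injective g h eq u = begin
  g u                                        ≡⟨ cong g (finToWord-wordToFin u) ⟨
  g (finToWord (wordToFin u))                ≡⟨ finToFun-funToFin (g ∘ finToWord) (wordToFin u) ⟨
  finToFun (encodeColouring g) (wordToFin u) ≡⟨ cong (λ c → finToFun c (wordToFin u)) eq ⟩
  finToFun (encodeColouring h) (wordToFin u) ≡⟨ finToFun-funToFin (h ∘ finToWord) (wordToFin u) ⟩
  h (finToWord (wordToFin u))                ≡⟨ cong h (finToWord-wordToFin u) ⟩
  h u                                        ∎
  where open ≡-Reasoning

record FocusedLines (s : ℕ) (χ : Vec (Fin (suc K)) N → Fin r) : Set where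
  field
    focus            : Vec (Fin (suc K)) N
    lines            : Fin s → Template (Fin (suc K)) N
    colour           : Fin s → Fin r
    colour-injective : Injective _≡_ _≡_ colour
    wildcard         : ∀ i → HasWildcard (lines i)
    meets-focus      : ∀ i → line (lines i) zero ≡ focus
    colour-off-focus : ∀ i a → χ (line (lines i) (suc a)) ≡ colour i

open FocusedLines

noFocusedLines : {χ : Vec (Fin (suc K)) 0 → Fin r} → FocusedLines 0 χ
noFocusedLines = record
  { focus            = []
  ; lines            = λ ()
  ; colour           = λ ()
  ; colour-injective = λ {i} _ → contradiction i ¬Fin0
  ; wildcard         = λ ()
  ; meets-focus      = λ ()
  ; colour-off-focus = λ ()
  }

focusedLines-monochromatic : {χ : Vec (Fin (suc K)) N → Fin r} (F : FocusedLines s χ) (i : Fin s) →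
  χ (focus F) ≡ colour F i → MonochromaticLine χ
focusedLines-monochromatic {χ = χ} F i focus≡ =
  lines F i , wildcard F i , λ a b → trans (onLine a) (sym (onLine b))
  where
  onLine : ∀ a → χ (line (lines F i) a) ≡ colour F i
  onLine zero    = trans (cong χ (meets-focus F i)) focus≡
  onLine (suc a) = colour-off-focus F i a

focusedLines-extend : {χ : Vec (Fin (suc K)) (M + N) → Fin r} {χ₀ : Vec (Fin (suc K)) N → Fin r}
  (σ : Template (Fin (suc K)) M) → HasWildcard σ → (∀ b u → χ (line σ (suc b) ++ u) ≡ χ₀ u) →
  (F : FocusedLines s χ₀) → (∀ i → χ₀ (focus F) ≢ colour F i) → FocusedLines (suc s) χ
focusedLines-extend {s = s} {χ = χ} {χ₀} σ wildσ σ-induces F fresh = record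
  { focus            = line σ zero ++ focus F
  ; lines            = lines′
  ; colour           = colour′
  ; colour-injective = colour′-injective
  ; wildcard         = wildcard′
  ; meets-focus      = meets-focus′
  ; colour-off-focus = colour-off-focus′
  }
  where
  lines′ : Fin (suc s) → Template (Fin (suc _)) _
  lines′ zero    = σ ++ constant (focus F)
  lines′ (suc i) = σ ++ lines F i

  colour′ : Fin (suc s) → Fin _
  colour′ zero    = χ₀ (focus F)
  colour′ (suc i) = colour F i

  colour′-injective : Injective _≡_ _≡_ colour′
  colour′-injective {zero}  {zero}  _ = refl
  colour′-injective {zero}  {suc j} e = ⊥-elim (fresh j e)
  colour′-injective {suc i} {zero}  e = ⊥-elim (fresh i (sym e))
  colour′-injective {suc i} {suc j} e = cong suc (colour-injective F e)

  wildcard′ : ∀ i → HasWildcard (lines′ i)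
  wildcard′ zero    = ++⁺ˡ wildσ
  wildcard′ (suc i) = ++⁺ˡ wildσ

  meets-focus′ : ∀ i → line (lines′ i) zero ≡ line σ zero ++ focus F
  meets-focus′ zero    = trans (line-++ σ _ zero) (cong (line σ zero ++_) (line-constant (focus F) zero))
  meets-focus′ (suc i) = trans (line-++ σ _ zero) (cong (line σ zero ++_) (meets-focus F i))

  offFocus : ∀ τ b → χ (line (σ ++ τ) (suc b)) ≡ χ₀ (line τ (suc b))
  offFocus τ b = trans (cong χ (line-++ σ τ (suc b))) (σ-induces b (line τ (suc b)))

  colour-off-focus′ : ∀ i b → χ (line (lines′ i) (suc b)) ≡ colour′ i
  colour-off-focus′ zero    b = trans (offFocus _ b) (cong χ₀ (line-constant (focus F) (suc b)))
  colour-off-focus′ (suc i) b = trans (offFocus _ b) (colour-off-focus F i b)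

-- The alphabet Fin (2 + K) consists of the focus letter zero and a copy suc of Fin (1 + K).
module ColourFocusing (K : ℕ) (halesJewett-K : HalesJewett (suc K)) (r : ℕ) where

  MonochromaticOrFocused : ℕ → Set
  MonochromaticOrFocused s = ∃ λ N → (χ : Vec (Fin (suc (suc K))) N → Fin r) →
    MonochromaticLine χ ⊎ FocusedLines s χ

  focusing : ∀ s → MonochromaticOrFocused s
  focusing zero    = 0 , λ _ → inj₂ noFocusedLines
  focusing (suc s) = Mₛ + Nₛ , step
    where
    Nₛ = proj₁ (focusing s)
    Mₛ = proj₁ (halesJewett-K (r ^ (suc (suc K) ^ Nₛ)))

    step : (χ : Vec (Fin (suc (suc K))) (Mₛ + Nₛ) → Fin r) → MonochromaticLine χ ⊎ FocusedLines (suc s) χ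
    step χ with proj₂ (halesJewett-K _) (λ v → encodeColouring (λ u → χ (map suc v ++ u)))
    ... | ℓ , wildℓ , monoℓ = finish (proj₂ (focusing s) χ₀)
      where
      -- χ on the words w ++ u depends only on u as w runs through the non-focus points of ℓ.
      χ₀ : Vec (Fin (suc (suc K))) Nₛ → Fin r
      χ₀ u = χ (map suc (line ℓ zero) ++ u)

      σ = map (Maybe.map suc) ℓ

      σ-induces : ∀ b u → χ (line σ (suc b) ++ u) ≡ χ₀ u
      σ-induces b u = trans (cong (λ w → χ (w ++ u)) (line-map suc ℓ b))
                            (encodeColouring-injective _ _ (monoℓ b zero) u)

      finish : MonochromaticLine χ₀ ⊎ FocusedLines s χ₀ → MonochromaticLine χ ⊎ FocusedLines (suc s) χ
      finish (inj₁ mono) = inj₁ (monochromaticLine-prefix (map suc (line ℓ zero)) {χ} mono)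
      finish (inj₂ F) with any? (λ i → χ₀ (focus F) ≟ colour F i)
      ... | yes (i , eq) =
        inj₁ (monochromaticLine-prefix (map suc (line ℓ zero)) {χ} (focusedLines-monochromatic F i eq))
      ... | no fresh =
        inj₂ (focusedLines-extend σ (hasWildcard-map suc wildℓ) σ-induces F (λ i eq → fresh (i , eq)))

  -- r + 1 focused lines would need r + 1 distinct colours.
  monochromaticLines : ∃ λ N → (χ : Vec (Fin (suc (suc K))) N → Fin r) → MonochromaticLine χ
  monochromaticLines = proj₁ (focusing (suc r)) , λ χ → [ id , tooManyColours ]′ (proj₂ (focusing (suc r)) χ)
    where
    tooManyColours : {χ : Vec (Fin (suc (suc K))) _ → Fin r} → FocusedLines (suc r) χ → MonochromaticLine χ
    tooManyColours F = contradiction (λ {i j} → colour-injective F {i} {j}) (<⇒notInjective (n<1+n r))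

halesJewett : ∀ K → HalesJewett (suc K)
halesJewett zero    = halesJewett-unary
halesJewett (suc K) r = ColourFocusing.monochromaticLines K (halesJewett K) r

wildcards : Template A N → ℕ
wildcards []            = 0
wildcards (nothing ∷ τ) = suc (wildcards τ)
wildcards (just _ ∷ τ)  = wildcards τ

wildcards-positive : {τ : Template A N} → HasWildcard τ → 0 < wildcards τ
wildcards-positive {τ = nothing ∷ _} _         = s≤s z≤n
wildcards-positive {τ = just _ ∷ _}  (here ())
wildcards-positive {τ = just _ ∷ _}  (there h) = wildcards-positive h

fixedSum : (A → ℕ) → Template A N → ℕ
fixedSum g τ = sum (map (maybe g 0) τ)

sum-line : (g : A → ℕ) (τ : Template A N) (a : A) →
  sum (map g (line τ a)) ≡ fixedSum g τ + wildcards τ * g a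
sum-line g []            a = refl
sum-line g (nothing ∷ τ) a = trans (cong (g a +_) (sum-line g τ a)) (x∙yz≈y∙xz (g a) (fixedSum g τ) _)
sum-line g (just b ∷ τ)  a = trans (cong (g b +_) (sum-line g τ a)) (sym (+-assoc (g b) (fixedSum g τ) _))

weight : (e o : A → ℕ) → Vec A N → ℕ
weight e o w = 2 ^ sum (map e w) * suc (sum (map o w))

weight-line : (e o : A → ℕ) (τ : Template A N) (a : A) →
  weight e o (line τ a) ≡
    2 ^ fixedSum e τ * 2 ^ (wildcards τ * e a) * (suc (fixedSum o τ) + wildcards τ * o a)
weight-line e o τ a = begin
  2 ^ sum (map e (line τ a)) * suc (sum (map o (line τ a)))
    ≡⟨ cong₂ (λ m k → 2 ^ m * suc k) (sum-line e τ a) (sum-line o τ a) ⟩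
  2 ^ (fixedSum e τ + wildcards τ * e a) * suc (fixedSum o τ + wildcards τ * o a)
    ≡⟨ cong (_* _) (^-distribˡ-+-* 2 (fixedSum e τ) _) ⟩
  2 ^ fixedSum e τ * 2 ^ (wildcards τ * e a) * (suc (fixedSum o τ) + wildcards τ * o a) ∎
  where open ≡-Reasoning

mainTheorem7 : (r n : ℕ) → (a : Fin n → ℕ) → (∀ i → 0 < a i) → Injective _≡_ _≡_ a →
    (χ : ℕ → Fin r) →
    Σ ℕ λ x → Σ ℕ λ y → Σ ℕ λ c → 0 < x × 0 < y × 0 < c ×
      Σ (Fin r) λ k → ∀ i → χ (elem x y c (a i)) ≡ k
mainTheorem7 r zero    a _ _ χ = 1 , 1 , 1 , s≤s z≤n , s≤s z≤n , s≤s z≤n , χ 0 , λ ()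
mainTheorem7 r (suc m) a _ _ χ =
  let τ , wild , mono = proj₂ (halesJewett m r) (χ ∘ weight e o) in
  2 ^ fixedSum e τ , suc (fixedSum o τ) , wildcards τ ,
  m^n>0 2 (fixedSum e τ) , s≤s z≤n , wildcards-positive wild ,
  χ (weight e o (line τ zero)) , λ i → trans (cong χ (sym (weight-line e o τ i))) (mono i zero)
  where
  e o : Fin (suc m) → ℕ
  e = f ∘ a
  o = oddPart ∘ a
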